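{- Let $\mathbb{F}$ be a field, let $A\in M_n(\mathbb{F})$, and let $\mathcal{B}$ be a linear subspace of $M_n(\mathbb{F})$ contained in $W_n(\mathbb{F})$. Suppose $B_1,\dots,B_t\in\mathcal{B}$ are nonzero and the sets $\tilde q(B_1),\dots,\tilde q(B_t)$ form a partition of $[n]=\{1,\dots,n\}$ (i.e. $\{\tilde q(B_1),\ldots,\tilde q(B_t)\}$ is a perfect matching of the complete graph with loops on $[n]$). Let $\delta_i=|\tilde q(B_i)|\in\{1,2\}$, so $\sum_{i=1}^t\delta_i=n$, and let $f(x_1,\dots,x_t)=\det\big(A+\sum_{i=1}^t x_iB_i\big)\in\mathbb{F}[x_1,\dots,x_t]$. Then the monomial $\prod_{i=1}^t x_i^{\delta_i}$ appears in $f$ with a nonzero coefficient.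
   Context: A matrix $A=(A(i,j))$ is weakly symmetric if for all $i,j$: $A(i,j)\neq 0$ iff $A(j,i)\neq0$; $W_n(\mathbb{F})$ is the set of weakly symmetric matrices in $M_n(\mathbb{F})$. Order $\{(i,j)\in[n]^2: i\le j\}$ colexicographically: $(i,j)\prec(i',j')$ iff $j<j'$, or $j=j'$ and $i<i'$. For $0\neq B\in W_n(\mathbb{F})$, $q(B)$ is the $\prec$-maximal pair $(i,j)$ with $i\le j$ and $B(i,j)\ne 0$, and if $q(B)=(i,j)$ then $\tilde q(B)=\{i,j\}$ (a set of size 1 or 2). -}

module Defs where

open import Level using (Level; _⊔_) renaming (suc to lsuc)
open import Data.Nat as ℕ using (ℕ; zero; suc)
open import Data.Fin as Fin using (Fin; zero; suc; toℕ; punchIn)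
open import Data.Bool using (Bool; true; false; if_then_else_)
open import Data.List using (List; []; _∷_; foldr; map; concatMap; upTo)
open import Data.Vec.Functional using () renaming (_∷_ to _∷ᵥ_)
open import Data.Product using (Σ; _×_; _,_; ∃; ∃-syntax)
open import Data.Sum using (_⊎_)
open import Relation.Nullary using (¬_; does)
open import Relation.Binary.PropositionalEquality using (_≡_)
open import Algebra.Bundles using (CommutativeRing)
open import Algebra.Bundles.Raw using (RawRing)

record Field (c ℓ : Level) : Set (lsuc (c ⊔ ℓ)) where
  field
    commutativeRing : CommutativeRing c ℓ
  open CommutativeRing commutativeRing public
  field
    1≉0     : ¬ (1# ≈ 0#)
    inverse : ∀ x → ¬ (x ≈ 0#) → ∃[ y ] (x * y ≈ 1#)

module Det {c ℓ} (R : RawRing c ℓ) where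
  open RawRing R

  Mat : ℕ → Set c
  Mat n = Fin n → Fin n → Carrier

  Σᶠ : ∀ n → (Fin n → Carrier) → Carrier
  Σᶠ zero    f = 0#
  Σᶠ (suc n) f = f zero + Σᶠ n (λ i → f (suc i))

  sign : ℕ → Carrier
  sign zero          = 1#
  sign (suc zero)    = - 1#
  sign (suc (suc k)) = sign k

  det : ∀ n → Mat n → Carrier
  det zero    M = 1#
  det (suc n) M =
    Σᶠ (suc n) (λ j → sign (toℕ j) * (M zero j * det n (λ r c → M (suc r) (punchIn j c))))

module OverField {c ℓ} (F : Field c ℓ) where
  open Field F using (Carrier; _≈_; _+_; _*_; -_; 0#; 1#)

  Matrix : ℕ → Set c
  Matrix n = Fin n → Fin n → Carrier

  NonZero : Carrier → Set ℓ
  NonZero x = ¬ (x ≈ 0#)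

  0ᴹ : ∀ {n} → Matrix n
  0ᴹ i j = 0#

  _+ᴹ_ : ∀ {n} → Matrix n → Matrix n → Matrix n
  (A +ᴹ B) i j = A i j + B i j

  _·ᴹ_ : ∀ {n} → Carrier → Matrix n → Matrix n
  (a ·ᴹ B) i j = a * B i j

  _≈ᴹ_ : ∀ {n} → Matrix n → Matrix n → Set ℓ
  A ≈ᴹ B = ∀ i j → A i j ≈ B i j

  WeaklySymmetric : ∀ {n} → Matrix n → Set ℓ
  WeaklySymmetric A = ∀ i j → (NonZero (A i j) → NonZero (A j i)) × (NonZero (A j i) → NonZero (A i j))

  record IsSubspace {n : ℕ} {p} (𝓑 : Matrix n → Set p) : Set (c ⊔ ℓ ⊔ p) where
    field
      resp  : ∀ {A B} → A ≈ᴹ B → 𝓑 A → 𝓑 B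
      zero∈ : 𝓑 0ᴹ
      +-closed : ∀ {A B} → 𝓑 A → 𝓑 B → 𝓑 (A +ᴹ B)
      ·-closed : ∀ a {B} → 𝓑 B → 𝓑 (a ·ᴹ B)

  _≺_ : ∀ {n} → Fin n × Fin n → Fin n × Fin n → Set
  (i , j) ≺ (i' , j') = (j Fin.< j') ⊎ ((j ≡ j') × (i Fin.< i'))

  IsQ : ∀ {n} → Matrix n → Fin n → Fin n → Set ℓ
  IsQ B i j = (i Fin.≤ j) × NonZero (B i j)
            × (∀ i' j' → i' Fin.≤ j' → (i , j) ≺ (i' , j') → B i' j' ≈ 0#)

  _∈₂_ : ∀ {n} → Fin n → Fin n × Fin n → Set
  v ∈₂ (i , j) = (v ≡ i) ⊎ (v ≡ j)

  Partition : ∀ {n t} → (Fin t → Fin n × Fin n) → Set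
  Partition {n} {t} q = ∀ (v : Fin n) → Σ (Fin t) λ k → (v ∈₂ q k) × (∀ k' → v ∈₂ q k' → k' ≡ k)

  card₂ : ∀ {n} → Fin n × Fin n → ℕ
  card₂ (i , j) = if does (i Fin.≟ j) then 1 else 2

  -- Polynomials in t variables over F, represented by their coefficient
  -- functions: a polynomial assigns a coefficient to every monomial
  -- (exponent vector) e : Fin t → ℕ.

  Mon : ℕ → Set
  Mon t = Fin t → ℕ

  Poly : ℕ → Set c
  Poly t = Mon t → Carrier

  sumL : List Carrier → Carrier
  sumL = foldr _+_ 0#

  below : ∀ t → Mon t → List (Mon t)
  below zero    e = (λ ()) ∷ []
  below (suc t) e =
    concatMap (λ k → map (λ r → k ∷ᵥ r) (below t (λ i → e (suc i)))) (upTo (suc (e zero)))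

  isZeroMon : ∀ {t} → Mon t → Bool
  isZeroMon {zero}  e = true
  isZeroMon {suc t} e with e zero
  ... | zero  = isZeroMon (λ i → e (suc i))
  ... | suc _ = false

  isVar : ∀ {t} → Fin t → Mon t → Bool
  isVar {suc t} zero    e with e zero
  ... | suc zero = isZeroMon (λ i → e (suc i))
  ... | _        = false
  isVar {suc t} (suc i) e with e zero
  ... | zero  = isVar i (λ k → e (suc k))
  ... | suc _ = false

  constP : ∀ {t} → Carrier → Poly t
  constP a e = if isZeroMon e then a else 0#

  varP : ∀ {t} → Fin t → Poly t
  varP i e = if isVar i e then 1# else 0#

  polyRawRing : ℕ → RawRing c ℓ
  polyRawRing t = record
    { Carrier = Poly t
    ; _≈_ = λ p q → ∀ e → p e ≈ q e
    ; _+_ = λ p q e → p e + q e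
    ; _*_ = λ p q e → sumL (map (λ a → p a * q (λ i → e i ℕ.∸ a i)) (below t e))
    ; -_  = λ p e → - p e
    ; 0#  = constP 0#
    ; 1#  = constP 1#
    }

  coeff : ∀ {t} → Poly t → Mon t → Carrier
  coeff p e = p e

  pencil : ∀ {n t} → Matrix n → (Fin t → Matrix n) → Fin n → Fin n → Poly t
  pencil {n} {t} A B r s =
    RawRing._+_ (polyRawRing t) (constP (A r s))
      (Det.Σᶠ (polyRawRing t) t (λ k → RawRing._*_ (polyRawRing t) (constP (B k r s)) (varP k)))

  detPencil : ∀ {n t} → Matrix n → (Fin t → Matrix n) → Poly t
  detPencil {n} {t} A B = Det.det (polyRawRing t) n (pencil A B)

-- Weigh the index v by 2^v and the variable x_k by 2^i + 2^j, where q(B_k) = (i , j). On pairs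
-- r ≤ s the colexicographic order is the order of 2^r + 2^s, so the maximality of q(B_k) together
-- with weak symmetry makes B_k(r , s) vanish unless 2^r + 2^s ≤ weight(x_k), with equality only for
-- {r , s} = q̃(B_k). Expanding minors along their first row, a monomial of top degree in the minor
-- with rows ρ and columns γ therefore has coefficient zero whenever its weight is below
-- Σ_r 2^(ρ r) + Σ_c 2^(γ c). The monomial Π x_k^δ_k attains this bound for the whole matrix, and
-- attaining it forces every row r to be paired with its partner in q̃ through the variable of its
-- own block: a single term survives, ± a product of nonzero entries.

module Submission where

open import Defs
open import Function using (_∘_; id)
open import Data.Bool using (true; false; if_then_else_)
open import Data.Empty using (⊥-elim)
open import Data.Nat as ℕ using (ℕ; zero; suc; _∸_)
import Data.Nat.Properties as ℕ
open import Data.Nat.Tactic.RingSolver using (solve-∀)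
open import Data.Fin as Fin using (Fin; zero; suc; toℕ; punchIn)
import Data.Fin.Properties as Fin
open import Data.Product using (_×_; _,_; ∃-syntax; proj₁; proj₂)
open import Function.Definitions using (Injective)
open import Data.Sum as Sum using (_⊎_; inj₁; inj₂)
open import Relation.Nullary using (¬_; does; yes; no)
open import Relation.Nullary.Negation using (¬¬-map)
open import Relation.Binary using (tri<; tri≈; tri>)
open import Relation.Binary.PropositionalEquality as ≡ using (_≡_; _≢_; _≗_)
open import Algebra.Bundles.Raw using (RawRing)
import Algebra.Properties.Semiring.Sum as SemiringSum

¬¬-∀ : ∀ {n p} {P : Fin n → Set p} → (∀ j → ¬ ¬ P j) → ¬ ¬ (∀ j → P j)
¬¬-∀ {zero}  h ¬∀ = ¬∀ (λ ())
¬¬-∀ {suc n} h ¬∀ = h zero λ p₀ → ¬¬-∀ (h ∘ suc) λ ps → ¬∀ λ where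
  zero    → p₀
  (suc j) → ps j

δ : ∀ {t} → Fin t → Fin t → ℕ
δ k i = if does (k Fin.≟ i) then 1 else 0

δ-refl : ∀ {t} (k : Fin t) → δ k k ≡ 1
δ-refl k with k Fin.≟ k
... | yes _   = ≡.refl
... | no k≢k = ⊥-elim (k≢k ≡.refl)

δ-≢ : ∀ {t} {k i : Fin t} → k ≢ i → δ k i ≡ 0
δ-≢ {k = k} {i} k≢i with k Fin.≟ i
... | yes k≡i = ⊥-elim (k≢i k≡i)
... | no _    = ≡.refl

-- The exponent vector of x^e / x_k; only used when e k > 0, as ∸ truncates at 0.
lower : ∀ {t} → Fin t → (Fin t → ℕ) → Fin t → ℕ
lower k e i = e i ∸ δ k i

lower-≢ : ∀ {t} {k i : Fin t} e → i ≢ k → lower k e i ≡ e i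
lower-≢ {k = k} {i} e i≢k = ≡.cong (e i ∸_) (δ-≢ (i≢k ∘ ≡.sym))

lower-self : ∀ {t} {k : Fin t} e {d} → e k ≡ suc d → lower k e k ≡ d
lower-self {k = k} e eₖ≡1+d = ≡.cong₂ _∸_ eₖ≡1+d (δ-refl k)

module ℕΣ where
  open SemiringSum ℕ.+-*-semiring public
    using (sum; sum-cong-≗; sum-replicate-zero; ∑-distrib-+; ∑-comm; ∑-permute; *-distribʳ-sum; sum-remove)
  open import Data.Nat using (_+_; _*_)

  sum-δ : ∀ {n} (a : Fin n) (f : Fin n → ℕ) → sum (λ v → δ a v * f v) ≡ f a
  sum-δ {suc n} zero    f = begin
    f zero + 0 + sum {n} (λ _ → 0)  ≡⟨ ≡.cong (f zero + 0 +_) (sum-replicate-zero n) ⟩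
    f zero + 0 + 0                  ≡⟨ ≡.trans (ℕ.+-identityʳ _) (ℕ.+-identityʳ _) ⟩
    f zero                          ∎
    where open ≡.≡-Reasoning
  sum-δ {suc n} (suc a) f = sum-δ a (f ∘ suc)

  sum-const-1 : ∀ n → sum {n} (λ _ → 1) ≡ n
  sum-const-1 zero    = ≡.refl
  sum-const-1 (suc n) = ≡.cong suc (sum-const-1 n)

  ∑-bump : ∀ {n} (f g : Fin n → ℕ) k d → (∀ i → i ≢ k → f i ≡ g i) → g k ≡ d + f k →
           sum f + d ≡ sum g
  ∑-bump {suc n} f g zero d f≗g gₖ = begin
    f zero + sum (f ∘ suc) + d   ≡⟨ rotate (f zero) _ d ⟩
    (d + f zero) + sum (f ∘ suc) ≡⟨ ≡.cong₂ _+_ (≡.sym gₖ) (sum-cong-≗ (λ i → f≗g (suc i) λ ())) ⟩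
    sum g                        ∎
    where
    open ≡.≡-Reasoning
    rotate : ∀ a b c → a + b + c ≡ (c + a) + b
    rotate = solve-∀
  ∑-bump {suc n} f g (suc k) d f≗g gₖ = begin
    f zero + sum (f ∘ suc) + d   ≡⟨ ℕ.+-assoc (f zero) _ d ⟩
    f zero + (sum (f ∘ suc) + d) ≡⟨ ≡.cong (f zero +_) (∑-bump (f ∘ suc) (g ∘ suc) k d f≗g′ gₖ) ⟩
    f zero + sum (g ∘ suc)       ≡⟨ ≡.cong (_+ sum (g ∘ suc)) (f≗g zero λ ()) ⟩
    sum g                        ∎
    where
    open ≡.≡-Reasoning
    f≗g′ : ∀ i → i ≢ k → f (suc i) ≡ g (suc i)
    f≗g′ i i≢k = f≗g (suc i) (i≢k ∘ Fin.suc-injective)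

  sum-δ₁ : ∀ {n} (a : Fin n) → sum (δ a) ≡ 1
  sum-δ₁ a = ≡.trans (sum-cong-≗ λ v → ≡.sym (ℕ.*-identityʳ (δ a v))) (sum-δ a (λ _ → 1))

  sum-lower : ∀ {t} (u : Fin t → ℕ) e k {d} → e k ≡ suc d →
              sum (λ i → lower k e i * u i) + u k ≡ sum (λ i → e i * u i)
  sum-lower u e k {d} eₖ≡1+d = ∑-bump _ _ k (u k) (λ i i≢k → ≡.cong (_* u i) (lower-≢ e i≢k)) (begin
    e k * u k                ≡⟨ ≡.cong (_* u k) eₖ≡1+d ⟩
    u k + d * u k            ≡⟨ ≡.cong (λ x → u k + x * u k) (lower-self e eₖ≡1+d) ⟨
    u k + lower k e k * u k  ∎)
    where open ≡.≡-Reasoning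

  sum-lower₁ : ∀ {t} e (k : Fin t) {d} → e k ≡ suc d → suc (sum (lower k e)) ≡ sum e
  sum-lower₁ e k eₖ≡1+d = ≡.trans (ℕ.+-comm 1 _) (∑-bump _ _ k 1 (λ i i≢k → lower-≢ e i≢k)
    (≡.trans eₖ≡1+d (≡.cong suc (≡.sym (lower-self e eₖ≡1+d)))))

+-cancel-<-≤ : ∀ {a b u x} → a ℕ.+ u ℕ.< b ℕ.+ x → x ℕ.≤ u → a ℕ.< b
+-cancel-<-≤ {a} {b} {u} h x≤u = ℕ.+-cancelʳ-< u a b (ℕ.<-≤-trans h (ℕ.+-monoʳ-≤ b x≤u))

+-cancel-≤-< : ∀ {a b u x} → a ℕ.+ u ℕ.≤ b ℕ.+ x → x ℕ.< u → a ℕ.< b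
+-cancel-≤-< {a} {b} {u} h x<u = ℕ.+-cancelʳ-< u a b (ℕ.≤-<-trans h (ℕ.+-monoʳ-< b x<u))

module FieldProperties {c ℓ} (F : Field c ℓ) where
  open Field F hiding (zero)
  open import Algebra.Properties.Ring ring using (-0#≈0#; -‿involutive)
  open import Relation.Binary.Reasoning.Setoid setoid
  open SemiringSum semiring public
    using (sum; sum-cong-≋; sum-replicate-zero; sum-remove; ∑-distrib-+; *-distribʳ-sum)
  open import Data.Vec.Functional using (removeAt)

  sgn : ℕ → Carrier
  sgn = Det.sign rawRing

  sgn≉0 : ∀ s → ¬ sgn s ≈ 0#
  sgn≉0 zero          = 1≉0
  sgn≉0 (suc zero)    -1≈0 = 1≉0 (begin
    1#        ≈⟨ -‿involutive 1# ⟨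
    - (- 1#)  ≈⟨ -‿cong -1≈0 ⟩
    - 0#      ≈⟨ -0#≈0# ⟩
    0#        ∎)
  sgn≉0 (suc (suc s)) = sgn≉0 s

  *-≉0 : ∀ {x y} → ¬ x ≈ 0# → ¬ y ≈ 0# → ¬ x * y ≈ 0#
  *-≉0 {x} {y} x≉0 y≉0 xy≈0 with inverse x x≉0
  ... | x⁻¹ , xx⁻¹≈1 = y≉0 (begin
    y              ≈⟨ *-identityˡ y ⟨
    1# * y         ≈⟨ *-congʳ (trans (sym xx⁻¹≈1) (*-comm x x⁻¹)) ⟩
    x⁻¹ * x * y    ≈⟨ *-assoc x⁻¹ x y ⟩
    x⁻¹ * (x * y)  ≈⟨ *-congˡ xy≈0 ⟩
    x⁻¹ * 0#       ≈⟨ zeroʳ x⁻¹ ⟩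
    0#             ∎)

  x≈0⇒x*y≈0 : ∀ {x y} → x ≈ 0# → x * y ≈ 0#
  x≈0⇒x*y≈0 {y = y} x≈0 = trans (*-congʳ x≈0) (zeroˡ y)

  y≈0⇒x*y≈0 : ∀ {x y} → y ≈ 0# → x * y ≈ 0#
  y≈0⇒x*y≈0 {x} y≈0 = trans (*-congˡ y≈0) (zeroʳ x)

  x≈0⇒x+y≈y : ∀ {x y} → x ≈ 0# → x + y ≈ y
  x≈0⇒x+y≈y {y = y} x≈0 = trans (+-congʳ x≈0) (+-identityˡ y)

  sum≈0 : ∀ {n} {f : Fin n → Carrier} → (∀ j → f j ≈ 0#) → sum f ≈ 0#
  sum≈0 {n} f≈0 = trans (sum-cong-≋ f≈0) (sum-replicate-zero n)

  ¬¬-sum≈0 : ∀ {n} {f : Fin n → Carrier} → (∀ j → ¬ ¬ f j ≈ 0#) → ¬ ¬ sum f ≈ 0#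
  ¬¬-sum≈0 f≈0 = ¬¬-map sum≈0 (¬¬-∀ f≈0)

  sum≉0 : ∀ {n} {f : Fin n → Carrier} j₀ → (∀ j → j ≢ j₀ → ¬ ¬ f j ≈ 0#) → ¬ f j₀ ≈ 0# →
          ¬ sum f ≈ 0#
  sum≉0 {suc n} {f} j₀ others fj₀≉0 Σ≈0 =
    ¬¬-sum≈0 (λ i → others (punchIn j₀ i) (Fin.punchInᵢ≢i j₀ i)) λ rest≈0 → fj₀≉0 (begin
      f j₀                        ≈⟨ +-identityʳ (f j₀) ⟨
      f j₀ + 0#                   ≈⟨ +-congˡ rest≈0 ⟨
      f j₀ + sum (removeAt f j₀)  ≈⟨ sum-remove f ⟨
      sum f                       ≈⟨ Σ≈0 ⟩
      0#                          ∎)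

module ListSum {c ℓ} (F : Field c ℓ) where
  open Field F hiding (zero)
  open OverField F using (sumL)
  open FieldProperties F
  open import Algebra.Properties.CommutativeSemigroup +-commutativeSemigroup using (interchange)
  open import Relation.Binary.Reasoning.Setoid setoid
  open import Data.List using (List; []; _∷_; _++_; map; concatMap; applyUpTo)
  import Data.List.Properties as List

  sumL-cong : ∀ {A : Set} {f g : A → Carrier} xs → (∀ a → f a ≈ g a) → sumL (map f xs) ≈ sumL (map g xs)
  sumL-cong []       f≈g = refl
  sumL-cong (x ∷ xs) f≈g = +-cong (f≈g x) (sumL-cong xs f≈g)

  sumL≈0 : ∀ {A : Set} {f : A → Carrier} xs → (∀ a → f a ≈ 0#) → sumL (map f xs) ≈ 0#
  sumL≈0 []       f≈0 = refl
  sumL≈0 (x ∷ xs) f≈0 = trans (x≈0⇒x+y≈y (f≈0 x)) (sumL≈0 xs f≈0)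

  sumL-++ : ∀ xs ys → sumL (xs ++ ys) ≈ sumL xs + sumL ys
  sumL-++ []       ys = sym (+-identityˡ _)
  sumL-++ (x ∷ xs) ys = trans (+-congˡ (sumL-++ xs ys)) (sym (+-assoc _ _ _))

  sumL-+ : ∀ {A : Set} (f g : A → Carrier) xs →
           sumL (map (λ a → f a + g a) xs) ≈ sumL (map f xs) + sumL (map g xs)
  sumL-+ f g []       = sym (+-identityˡ 0#)
  sumL-+ f g (x ∷ xs) = trans (+-congˡ (sumL-+ f g xs)) (interchange (f x) (g x) _ _)

  *-distribˡ-sumL : ∀ {A : Set} x (f : A → Carrier) xs → x * sumL (map f xs) ≈ sumL (map (λ a → x * f a) xs)
  *-distribˡ-sumL x f []       = zeroʳ x
  *-distribˡ-sumL x f (y ∷ ys) = trans (distribˡ x (f y) _) (+-congˡ (*-distribˡ-sumL x f ys))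

  sumL-sum : ∀ {A : Set} {n} (h : Fin n → A → Carrier) xs →
             sumL (map (λ a → sum (λ k → h k a)) xs) ≈ sum (λ k → sumL (map (h k) xs))
  sumL-sum {n = n} h [] = sym (sum≈0 {n} (λ _ → refl))
  sumL-sum h (x ∷ xs) = trans (+-congˡ (sumL-sum h xs)) (sym (∑-distrib-+ (λ k → h k x) _))

  sumL-concatMap : ∀ {A B : Set} (h : B → Carrier) (G : A → List B) xs →
                   sumL (map h (concatMap G xs)) ≈ sumL (map (λ a → sumL (map h (G a))) xs)
  sumL-concatMap h G []       = refl
  sumL-concatMap h G (x ∷ xs) = begin
    sumL (map h (G x ++ concatMap G xs))              ≡⟨ ≡.cong sumL (List.map-++ h (G x) _) ⟩
    sumL (map h (G x) ++ map h (concatMap G xs))      ≈⟨ sumL-++ (map h (G x)) _ ⟩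
    sumL (map h (G x)) + sumL (map h (concatMap G xs)) ≈⟨ +-congˡ (sumL-concatMap h G xs) ⟩
    sumL (map h (G x)) + sumL (map (λ a → sumL (map h (G a))) xs) ∎

  sumL-applyUpTo≈0 : (f : ℕ → Carrier) (g : ℕ → ℕ) (N : ℕ) → (∀ x → f (g x) ≈ 0#) →
                     sumL (map f (applyUpTo g N)) ≈ 0#
  sumL-applyUpTo≈0 f g zero    fg≈0 = refl
  sumL-applyUpTo≈0 f g (suc N) fg≈0 =
    trans (x≈0⇒x+y≈y (fg≈0 0)) (sumL-applyUpTo≈0 f (g ∘ suc) N (fg≈0 ∘ suc))

module Coefficients {c ℓ} (F : Field c ℓ) where
  open Field F hiding (zero)
  open OverField F
  open FieldProperties F
  open ListSum F
  open import Relation.Binary.Reasoning.Setoid setoid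
  open import Data.List using (List; map; applyUpTo; upTo)
  import Data.List.Properties as List
  open import Data.Vec.Functional using () renaming (_∷_ to _∷ᵥ_)

  _*ₚ_ : ∀ {t} → Poly t → Poly t → Poly t
  _*ₚ_ {t} = RawRing._*_ (polyRawRing t)

  signₚ : ∀ {t} → ℕ → Poly t
  signₚ {t} = Det.sign (polyRawRing t)

  detₚ : ∀ {t} m → (Fin m → Fin m → Poly t) → Poly t
  detₚ {t} = Det.det (polyRawRing t)

  -- A polynomial is a bare coefficient function, so nothing forces X e ≈ X e′ for pointwise equal
  -- exponent vectors; the polynomials built from constP and varP by the ring operations do satisfy it.
  Congruent : ∀ {t} → Poly t → Set ℓ
  Congruent X = ∀ {e e′} → e ≗ e′ → X e ≈ X e′

  ∷ᵥ-cong : ∀ {t} x {a a′ : Mon t} → a ≗ a′ → (x ∷ᵥ a) ≗ (x ∷ᵥ a′)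
  ∷ᵥ-cong x a≗a′ zero    = ≡.refl
  ∷ᵥ-cong x a≗a′ (suc i) = a≗a′ i

  Slices : ∀ {t} → (Mon (suc t) → Carrier) → List (Mon t) → List ℕ → Carrier
  Slices h es xs = sumL (map (λ x → sumL (map (λ r → h (x ∷ᵥ r)) es)) xs)

  Slices≈0 : ∀ {t} (h : Mon (suc t) → Carrier) es g N → (∀ x r → h (g x ∷ᵥ r) ≈ 0#) →
             Slices h es (applyUpTo g N) ≈ 0#
  Slices≈0 h es g N h≈0 = sumL-applyUpTo≈0 _ g N λ x → sumL≈0 es (h≈0 x)

  sumL-below-suc : ∀ {t} (h : Mon (suc t) → Carrier) e →
    sumL (map h (below (suc t) e)) ≈ Slices h (below t (e ∘ suc)) (upTo (suc (e zero)))
  sumL-below-suc {t} h e = trans (sumL-concatMap h (λ x → map (x ∷ᵥ_) es) (upTo (suc (e zero))))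
    (sumL-cong (upTo (suc (e zero))) λ x → reflexive (≡.cong sumL (≡.sym (List.map-∘ es))))
    where
    es : List (Mon t)
    es = below t (e ∘ suc)

  sumL-below-constP : ∀ {t} a (Y : Poly t) → Congruent Y → ∀ e →
    sumL (map (λ b → constP a b * Y b) (below t e)) ≈ a * Y (λ _ → 0)
  sumL-below-constP {zero}  a Y Y-cong e = trans (+-identityʳ _) (*-congˡ (Y-cong λ ()))
  sumL-below-constP {suc t} a Y Y-cong e = begin
    _                            ≈⟨ sumL-below-suc (λ b → constP a b * Y b) e ⟩
    _ + _                        ≈⟨ +-cong (sumL-below-constP a (Y ∘ (0 ∷ᵥ_)) (Y-cong ∘ ∷ᵥ-cong 0) (e ∘ suc))
                                           (Slices≈0 (λ b → constP a b * Y b) es suc (e zero) λ _ _ → zeroˡ _) ⟩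
    a * Y (0 ∷ᵥ (λ _ → 0)) + 0#  ≈⟨ +-identityʳ _ ⟩
    a * Y (0 ∷ᵥ (λ _ → 0))       ≈⟨ *-congˡ (Y-cong λ { zero → ≡.refl ; (suc i) → ≡.refl }) ⟩
    a * Y (λ _ → 0)              ∎
    where
    es : List (Mon t)
    es = below t (e ∘ suc)

  sumL-below-varP-zero : ∀ {t} k (Y : Poly t) e → e k ≡ 0 →
    sumL (map (λ b → varP k b * Y b) (below t e)) ≈ 0#
  sumL-below-varP-zero {suc t} zero Y e eₖ≡0 = trans (sumL-below-suc _ e) (vanish (e zero) eₖ≡0)
    where
    vanish : ∀ N → N ≡ 0 → Slices (λ b → varP zero b * Y b) (below t (e ∘ suc)) (upTo (suc N)) ≈ 0#
    vanish zero ≡.refl = trans (+-identityʳ _) (sumL≈0 (below t (e ∘ suc)) λ _ → zeroˡ _)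
  sumL-below-varP-zero {suc t} (suc k) Y e eₖ≡0 = trans (sumL-below-suc _ e)
    (trans (x≈0⇒x+y≈y (sumL-below-varP-zero k (Y ∘ (0 ∷ᵥ_)) (e ∘ suc) eₖ≡0))
           (Slices≈0 (λ b → varP (suc k) b * Y b) (below t (e ∘ suc)) suc (e zero) λ _ _ → zeroˡ _))

  sumL-below-varP-suc : ∀ {t} k (Y : Poly t) → Congruent Y → ∀ e {m} → e k ≡ suc m →
    sumL (map (λ b → varP k b * Y b) (below t e)) ≈ Y (δ k)
  sumL-below-varP-suc {suc t} zero Y Y-cong e {m} eₖ≡1+m = trans (sumL-below-suc _ e) (only-x≡1 (e zero) eₖ≡1+m)
    where
    es : List (Mon t)
    es = below t (e ∘ suc)
    only-x≡1 : ∀ N → N ≡ suc m →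
               Slices (λ b → varP zero b * Y b) es (upTo (suc N)) ≈ Y (δ zero)
    only-x≡1 (suc N) ≡.refl = begin
      _ + (_ + _)                   ≈⟨ x≈0⇒x+y≈y (sumL≈0 es λ _ → zeroˡ _) ⟩
      _ + _                         ≈⟨ +-cong (sumL-below-constP 1# (Y ∘ (1 ∷ᵥ_)) (Y-cong ∘ ∷ᵥ-cong 1) (e ∘ suc))
                                              (Slices≈0 (λ b → varP zero b * Y b) es (λ x → suc (suc x)) N
                                                        λ _ _ → zeroˡ _) ⟩
      1# * Y (1 ∷ᵥ (λ _ → 0)) + 0#  ≈⟨ trans (+-identityʳ _) (*-identityˡ _) ⟩
      Y (1 ∷ᵥ (λ _ → 0))            ≈⟨ Y-cong (λ { zero → ≡.refl ; (suc i) → ≡.refl }) ⟩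
      Y (δ zero)                    ∎
  sumL-below-varP-suc {suc t} (suc k) Y Y-cong e eₖ≡1+m = begin
    _              ≈⟨ sumL-below-suc _ e ⟩
    _ + _          ≈⟨ +-cong (sumL-below-varP-suc k (Y ∘ (0 ∷ᵥ_)) (Y-cong ∘ ∷ᵥ-cong 0) (e ∘ suc) eₖ≡1+m)
                             (Slices≈0 (λ b → varP (suc k) b * Y b) (below t (e ∘ suc)) suc (e zero)
                                       λ _ _ → zeroˡ _) ⟩
    Y (0 ∷ᵥ δ k) + 0#  ≈⟨ +-identityʳ _ ⟩
    Y (0 ∷ᵥ δ k)       ≈⟨ Y-cong (λ { zero → ≡.refl ; (suc i) → ≡.refl }) ⟩
    Y (δ (suc k))      ∎

  isZeroMon-cong : ∀ {t} {a b : Mon t} → a ≗ b → isZeroMon a ≡ isZeroMon b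
  isZeroMon-cong {zero}          _   = ≡.refl
  isZeroMon-cong {suc t} {a} {b} a≗b with a zero | b zero | a≗b zero
  ... | zero  | .zero    | ≡.refl = isZeroMon-cong (a≗b ∘ suc)
  ... | suc _ | .(suc _) | ≡.refl = ≡.refl

  isVar-cong : ∀ {t} k {a b : Mon t} → a ≗ b → isVar k a ≡ isVar k b
  isVar-cong {suc t} zero {a} {b} a≗b with a zero | b zero | a≗b zero
  ... | zero        | .zero          | ≡.refl = ≡.refl
  ... | suc zero    | .(suc zero)    | ≡.refl = isZeroMon-cong (a≗b ∘ suc)
  ... | suc (suc _) | .(suc (suc _)) | ≡.refl = ≡.refl
  isVar-cong {suc t} (suc k) {a} {b} a≗b with a zero | b zero | a≗b zero
  ... | zero  | .zero    | ≡.refl = isVar-cong k (a≗b ∘ suc)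
  ... | suc _ | .(suc _) | ≡.refl = ≡.refl

  constP-cong : ∀ {t} a → Congruent {t} (constP a)
  constP-cong a e≗e′ = reflexive (≡.cong (λ b → if b then a else 0#) (isZeroMon-cong e≗e′))

  varP-cong : ∀ {t} k → Congruent {t} (varP k)
  varP-cong k e≗e′ = reflexive (≡.cong (λ b → if b then 1# else 0#) (isVar-cong k e≗e′))

  isZeroMon-true : ∀ {t} (e : Mon t) → ℕΣ.sum e ≡ 0 → isZeroMon e ≡ true
  isZeroMon-true {zero}  e _ = ≡.refl
  isZeroMon-true {suc t} e Σe≡0 with e zero
  ... | zero = isZeroMon-true (e ∘ suc) Σe≡0
  isZeroMon-true {suc t} e () | suc _

  isZeroMon-false : ∀ {t} (e : Mon t) → 0 ℕ.< ℕΣ.sum e → isZeroMon e ≡ false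
  isZeroMon-false {suc t} e 0<Σe with e zero
  ... | zero  = isZeroMon-false (e ∘ suc) 0<Σe
  ... | suc _ = ≡.refl

  constP-deg≡0 : ∀ {t} a (e : Mon t) → ℕΣ.sum e ≡ 0 → constP a e ≡ a
  constP-deg≡0 a e Σe≡0 = ≡.cong (λ b → if b then a else 0#) (isZeroMon-true e Σe≡0)

  constP-deg>0 : ∀ {t} a (e : Mon t) → 0 ℕ.< ℕΣ.sum e → constP a e ≡ 0#
  constP-deg>0 a e 0<Σe = ≡.cong (λ b → if b then a else 0#) (isZeroMon-false e 0<Σe)

  constP-0# : ∀ {t} (e : Mon t) → constP 0# e ≈ 0#
  constP-0# e with isZeroMon e
  ... | true  = refl
  ... | false = refl

  coeff-Σᶠ : ∀ {t} n (f : Fin n → Poly t) e → Det.Σᶠ (polyRawRing t) n f e ≈ sum (λ j → f j e)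
  coeff-Σᶠ zero    f e = constP-0# e
  coeff-Σᶠ (suc n) f e = +-congˡ (coeff-Σᶠ n (f ∘ suc) e)

  coeff-sign : ∀ {t} s (e : Mon t) → signₚ s e ≈ constP (sgn s) e
  coeff-sign zero          e = refl
  coeff-sign (suc zero)    e with isZeroMon e
  ... | true  = refl
  ... | false = -0#≈0#
    where open import Algebra.Properties.Ring ring using (-0#≈0#)
  coeff-sign (suc (suc s)) e = coeff-sign s e

  sumL-below-cong : ∀ {t} {f g : Mon t → Carrier} {e e′} → e ≗ e′ →
    (∀ {b b′} → b ≗ b′ → f b ≈ g b′) →
    sumL (map f (below t e)) ≈ sumL (map g (below t e′))
  sumL-below-cong {zero}                    _    f≈g = +-congʳ (f≈g λ ())
  sumL-below-cong {suc t} {f} {g} {e} {e′} e≗e′ f≈g = begin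
    sumL (map f (below (suc t) e))
      ≈⟨ sumL-below-suc f e ⟩
    sumL (map (λ x → sumL (map (f ∘ (x ∷ᵥ_)) (below t (e ∘ suc)))) (upTo (suc (e zero))))
      ≈⟨ sumL-cong (upTo (suc (e zero))) (λ x → sumL-below-cong (e≗e′ ∘ suc) (f≈g ∘ ∷ᵥ-cong x)) ⟩
    sumL (map (λ x → sumL (map (g ∘ (x ∷ᵥ_)) (below t (e′ ∘ suc)))) (upTo (suc (e zero))))
      ≡⟨ ≡.cong (λ N → sumL (map _ (upTo (suc N)))) (e≗e′ zero) ⟩
    sumL (map (λ x → sumL (map (g ∘ (x ∷ᵥ_)) (below t (e′ ∘ suc)))) (upTo (suc (e′ zero))))
      ≈⟨ sumL-below-suc g e′ ⟨
    sumL (map g (below (suc t) e′)) ∎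

  *ₚ-cong : ∀ {t} {X Y : Poly t} → Congruent X → Congruent Y → Congruent (X *ₚ Y)
  *ₚ-cong X-cong Y-cong e≗e′ =
    sumL-below-cong e≗e′ λ b≗b′ → *-cong (X-cong b≗b′) (Y-cong λ i → ≡.cong₂ _∸_ (e≗e′ i) (b≗b′ i))

  Σᶠ-cong : ∀ {t} n (f : Fin n → Poly t) → (∀ j → Congruent (f j)) →
            Congruent (Det.Σᶠ (polyRawRing t) n f)
  Σᶠ-cong n f f-cong {e} {e′} e≗e′ =
    trans (coeff-Σᶠ n f e) (trans (sum-cong-≋ λ j → f-cong j e≗e′) (sym (coeff-Σᶠ n f e′)))

  sign-cong : ∀ {t} s → Congruent {t} (signₚ s)
  sign-cong s {e} {e′} e≗e′ =
    trans (coeff-sign s e) (trans (constP-cong (sgn s) e≗e′) (sym (coeff-sign s e′)))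

  det-cong : ∀ {t} m (M : Fin m → Fin m → Poly t) → (∀ r s → Congruent (M r s)) → Congruent (detₚ m M)
  det-cong zero    M M-cong = constP-cong 1#
  det-cong (suc m) M M-cong = Σᶠ-cong (suc m) _ λ j →
    *ₚ-cong (sign-cong (toℕ j)) (*ₚ-cong (M-cong zero j) (det-cong m _ λ r s → M-cong (suc r) (punchIn j s)))

  coeff-det-suc : ∀ {t} m (M : Fin (suc m) → Fin (suc m) → Poly t) e →
    detₚ (suc m) M e ≈
    sum (λ j → (signₚ (toℕ j) *ₚ (M zero j *ₚ detₚ m (λ r s → M (suc r) (punchIn j s)))) e)
  coeff-det-suc m M e =
    coeff-Σᶠ (suc m) (λ j → signₚ (toℕ j) *ₚ (M zero j *ₚ detₚ m (λ r s → M (suc r) (punchIn j s)))) e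

  constP-*ₚ : ∀ {t} a (X : Poly t) → Congruent X → ∀ e → (constP a *ₚ X) e ≈ a * X e
  constP-*ₚ a X X-cong e = sumL-below-constP a _ (λ b≗b′ → X-cong λ i → ≡.cong (e i ∸_) (b≗b′ i)) e

  sign-*ₚ : ∀ {t} s (X : Poly t) → Congruent X → ∀ e → (signₚ s *ₚ X) e ≈ sgn s * X e
  sign-*ₚ s X X-cong e =
    trans (sumL-cong (below _ e) λ b → *-congʳ (coeff-sign s b)) (constP-*ₚ (sgn s) X X-cong e)

  varP-*ₚ-zero : ∀ {t} k (X : Poly t) e → e k ≡ 0 → (varP k *ₚ X) e ≈ 0#
  varP-*ₚ-zero k X e = sumL-below-varP-zero k _ e

  varP-*ₚ-suc : ∀ {t} k (X : Poly t) → Congruent X → ∀ e {m} → e k ≡ suc m →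
                (varP k *ₚ X) e ≈ X (lower k e)
  varP-*ₚ-suc k X X-cong e = sumL-below-varP-suc k _ (λ b≗b′ → X-cong λ i → ≡.cong (e i ∸_) (b≗b′ i)) e

module Pencil {c ℓ} (F : Field c ℓ) {n t : ℕ} (A : OverField.Matrix F n) (B : Fin t → OverField.Matrix F n) where
  open Field F hiding (zero)
  open OverField F
  open FieldProperties F
  open ListSum F
  open Coefficients F
  open import Relation.Binary.Reasoning.Setoid setoid
  open import Data.List using (List; map)

  minor : ∀ {m} → (Fin m → Fin n) → (Fin m → Fin n) → Fin m → Fin m → Poly t
  minor ρ γ r s = pencil A B (ρ r) (γ s)

  cofactor : ∀ {m} → (Fin (suc m) → Fin n) → (Fin (suc m) → Fin n) → Fin (suc m) → Poly t
  cofactor {m} ρ γ j = detₚ m (minor (ρ ∘ suc) (γ ∘ punchIn j))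

  coeff-pencil : ∀ r s e → pencil A B r s e ≈ constP (A r s) e + sum (λ k → B k r s * varP k e)
  coeff-pencil r s e =
    +-congˡ (trans (coeff-Σᶠ t _ e) (sum-cong-≋ λ k → constP-*ₚ (B k r s) (varP k) (varP-cong k) e))

  pencil-cong : ∀ r s → Congruent (pencil A B r s)
  pencil-cong r s e≗e′ =
    +-cong (constP-cong (A r s) e≗e′) (Σᶠ-cong t _ (λ k → *ₚ-cong (constP-cong (B k r s)) (varP-cong k)) e≗e′)

  det-minor-cong : ∀ m (ρ γ : Fin m → Fin n) → Congruent (detₚ m (minor ρ γ))
  det-minor-cong m ρ γ = det-cong m (minor ρ γ) λ r s → pencil-cong (ρ r) (γ s)

  pencil-*ₚ : ∀ r s (X : Poly t) → Congruent X → ∀ e →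
    (pencil A B r s *ₚ X) e ≈ A r s * X e + sum (λ k → B k r s * (varP k *ₚ X) e)
  pencil-*ₚ r s X X-cong e = begin
    sumL (map (λ b → pencil A B r s b * X′ b) bs)
      ≈⟨ sumL-cong bs (λ b → trans (*-congʳ (coeff-pencil r s b)) (distribʳ _ _ _)) ⟩
    sumL (map (λ b → constP (A r s) b * X′ b + sum (λ k → B k r s * varP k b) * X′ b) bs)
      ≈⟨ sumL-+ _ _ bs ⟩
    (constP (A r s) *ₚ X) e + sumL (map (λ b → sum (λ k → B k r s * varP k b) * X′ b) bs)
      ≈⟨ +-cong (constP-*ₚ (A r s) X X-cong e)
                (sumL-cong bs λ b → trans (*-distribʳ-sum (X′ b) (λ k → B k r s * varP k b))
                                          (sum-cong-≋ {t} λ k → *-assoc _ _ _)) ⟩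
    A r s * X e + sumL (map (λ b → sum (λ k → B k r s * (varP k b * X′ b))) bs)
      ≈⟨ +-congˡ (sumL-sum (λ k b → B k r s * (varP k b * X′ b)) bs) ⟩
    A r s * X e + sum (λ k → sumL (map (λ b → B k r s * (varP k b * X′ b)) bs))
      ≈⟨ +-congˡ (sum-cong-≋ λ k → sym (*-distribˡ-sumL (B k r s) _ bs)) ⟩
    A r s * X e + sum (λ k → B k r s * (varP k *ₚ X) e) ∎
    where
    bs : List (Mon t)
    bs = below t e
    X′ : Mon t → Carrier
    X′ b = X (λ i → e i ∸ b i)

  constantTerm : ∀ {m} (ρ γ : Fin (suc m) → Fin n) → Mon t → Fin (suc m) → Carrier
  constantTerm ρ γ e j = A (ρ zero) (γ j) * cofactor ρ γ j e

  variableTerm : ∀ {m} (ρ γ : Fin (suc m) → Fin n) → Mon t → Fin (suc m) → Fin t → Carrier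
  variableTerm ρ γ e j k = B k (ρ zero) (γ j) * (varP k *ₚ cofactor ρ γ j) e

  expansionTerm : ∀ {m} (ρ γ : Fin (suc m) → Fin n) → Mon t → Fin (suc m) → Carrier
  expansionTerm ρ γ e j = sgn (toℕ j) * (constantTerm ρ γ e j + sum (variableTerm ρ γ e j))

  coeff-det-minor : ∀ {m} (ρ γ : Fin (suc m) → Fin n) e →
                    detₚ (suc m) (minor ρ γ) e ≈ sum (expansionTerm ρ γ e)
  coeff-det-minor {m} ρ γ e = trans (coeff-det-suc m (minor ρ γ) e) (sum-cong-≋ λ j →
    let cofactor-cong = det-minor-cong m (ρ ∘ suc) (γ ∘ punchIn j) in
    trans (sign-*ₚ (toℕ j) (pencil A B (ρ zero) (γ j) *ₚ cofactor ρ γ j)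
                   (*ₚ-cong (pencil-cong _ _) cofactor-cong) e)
          (*-congˡ (pencil-*ₚ (ρ zero) (γ j) (cofactor ρ γ j) cofactor-cong e)))

  expansionTerm≈0 : ∀ {m} (ρ γ : Fin (suc m) → Fin n) e j → constantTerm ρ γ e j ≈ 0# →
                    (∀ k → variableTerm ρ γ e j k ≈ 0#) → expansionTerm ρ γ e j ≈ 0#
  expansionTerm≈0 ρ γ e j c≈0 v≈0 = y≈0⇒x*y≈0 (trans (x≈0⇒x+y≈y c≈0) (sum≈0 v≈0))

  variableTerm-zero : ∀ {m} (ρ γ : Fin (suc m) → Fin n) e j k → e k ≡ 0 → variableTerm ρ γ e j k ≈ 0#
  variableTerm-zero ρ γ e j k eₖ≡0 = y≈0⇒x*y≈0 (varP-*ₚ-zero k (cofactor ρ γ j) e eₖ≡0)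

  variableTerm-lower : ∀ {m} (ρ γ : Fin (suc m) → Fin n) e j k {d} → e k ≡ suc d →
    variableTerm ρ γ e j k ≈ B k (ρ zero) (γ j) * cofactor ρ γ j (lower k e)
  variableTerm-lower {m} ρ γ e j k eₖ≡1+d =
    *-congˡ (varP-*ₚ-suc k (cofactor ρ γ j) (det-minor-cong m _ _) e eₖ≡1+d)

module Blocks {c ℓ} (F : Field c ℓ) {n t : ℕ} (q : Fin t → Fin n × Fin n)
  (q-partition : OverField.Partition F q) where
  open OverField F using (_∈₂_; card₂)

  _≐_ : Fin n × Fin n → Fin n × Fin n → Set
  (r , s) ≐ (i , j) = (r ≡ i × s ≡ j) ⊎ (r ≡ j × s ≡ i)

  ≐-swap : ∀ {r s p} → (r , s) ≐ p → (s , r) ≐ p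
  ≐-swap (inj₁ (r≡i , s≡j)) = inj₂ (s≡j , r≡i)
  ≐-swap (inj₂ (r≡j , s≡i)) = inj₁ (s≡i , r≡j)

  ≐⇒∈₂ : ∀ {r s p} → (r , s) ≐ p → r ∈₂ p
  ≐⇒∈₂ (inj₁ (r≡i , _)) = inj₁ r≡i
  ≐⇒∈₂ (inj₂ (r≡j , _)) = inj₂ r≡j

  ≐-functional : ∀ {r s s′ p} → (r , s) ≐ p → (r , s′) ≐ p → s ≡ s′
  ≐-functional (inj₁ (_ , ≡.refl)) (inj₁ (_ , ≡.refl)) = ≡.refl
  ≐-functional (inj₁ (≡.refl , ≡.refl)) (inj₂ (≡.refl , ≡.refl)) = ≡.refl
  ≐-functional (inj₂ (≡.refl , ≡.refl)) (inj₁ (≡.refl , ≡.refl)) = ≡.refl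
  ≐-functional (inj₂ (_ , ≡.refl)) (inj₂ (_ , ≡.refl)) = ≡.refl

  block : Fin n → Fin t
  block v = proj₁ (q-partition v)

  ∈₂-block : ∀ v → v ∈₂ q (block v)
  ∈₂-block v = proj₁ (proj₂ (q-partition v))

  block-unique : ∀ {v k} → v ∈₂ q k → k ≡ block v
  block-unique {v} {k} = proj₂ (proj₂ (q-partition v)) k

  partner : Fin n → Fin n
  partner v with ∈₂-block v
  ... | inj₁ _ = proj₂ (q (block v))
  ... | inj₂ _ = proj₁ (q (block v))

  ≐-partner : ∀ v → (v , partner v) ≐ q (block v)
  ≐-partner v with ∈₂-block v
  ... | inj₁ v≡i = inj₁ (v≡i , ≡.refl)
  ... | inj₂ v≡j = inj₂ (v≡j , ≡.refl)

  partner⇒≐ : ∀ {v s} → s ≡ partner v → (v , s) ≐ q (block v)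
  partner⇒≐ {v} s≡partner = ≡.subst (λ s → (v , s) ≐ q (block v)) (≡.sym s≡partner) (≐-partner v)

  ≐⇒block : ∀ {v s k} → (v , s) ≐ q k → k ≡ block v
  ≐⇒block = block-unique ∘ ≐⇒∈₂

  ≐⇒partner : ∀ {v s k} → (v , s) ≐ q k → s ≡ partner v
  ≐⇒partner {v} {s} vs≐qk =
    ≐-functional (≡.subst (λ k → (v , s) ≐ q k) (≐⇒block vs≐qk) vs≐qk) (≐-partner v)

  partner-involutive : ∀ v → partner (partner v) ≡ v
  partner-involutive v = ≡.sym (≐⇒partner (≐-swap (≐-partner v)))

  partner-injective : Injective _≡_ _≡_ partner
  partner-injective {v} {v′} p≡p′ =
    ≡.trans (≡.sym (partner-involutive v)) (≡.trans (≡.cong partner p≡p′) (partner-involutive v′))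

  [_∈₂_] : Fin n → Fin n × Fin n → ℕ
  [ v ∈₂ (i , j) ] = if does (i Fin.≟ j) then δ i v else δ i v ℕ.+ δ j v

  [∈₂]-in : ∀ {v} p → v ∈₂ p → [ v ∈₂ p ] ≡ 1
  [∈₂]-in (i , j) v∈p with i Fin.≟ j | v∈p
  ... | yes ≡.refl | inj₁ ≡.refl = δ-refl i
  ... | yes ≡.refl | inj₂ ≡.refl = δ-refl i
  ... | no i≢j     | inj₁ ≡.refl = ≡.cong₂ ℕ._+_ (δ-refl i) (δ-≢ (i≢j ∘ ≡.sym))
  ... | no i≢j     | inj₂ ≡.refl = ≡.cong₂ ℕ._+_ (δ-≢ i≢j) (δ-refl j)

  [∈₂]-out : ∀ {v} p → ¬ v ∈₂ p → [ v ∈₂ p ] ≡ 0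
  [∈₂]-out {v} (i , j) v∉p with i Fin.≟ j
  ... | yes _ = δ-≢ (v∉p ∘ inj₁ ∘ ≡.sym)
  ... | no  _ = ≡.cong₂ ℕ._+_ (δ-≢ (v∉p ∘ inj₁ ∘ ≡.sym)) (δ-≢ (v∉p ∘ inj₂ ∘ ≡.sym))

  δ-block : ∀ v k → δ (block v) k ≡ [ v ∈₂ q k ]
  δ-block v k with block v Fin.≟ k
  ... | yes ≡.refl = ≡.sym ([∈₂]-in (q k) (∈₂-block v))
  ... | no  bv≢k   = ≡.sym ([∈₂]-out (q k) (bv≢k ∘ ≡.sym ∘ block-unique))

  sum-[∈₂] : ∀ p → ℕΣ.sum (λ v → [ v ∈₂ p ]) ≡ card₂ p
  sum-[∈₂] (i , j) with i Fin.≟ j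
  ... | yes _ = ℕΣ.sum-δ₁ i
  ... | no  _ = ≡.trans (ℕΣ.∑-distrib-+ (δ i) (δ j)) (≡.cong₂ ℕ._+_ (ℕΣ.sum-δ₁ i) (ℕΣ.sum-δ₁ j))

  wt : Fin n → ℕ
  wt v = 2 ℕ.^ toℕ v

  blockWeight : Fin t → ℕ
  blockWeight k = wt (proj₁ (q k)) ℕ.+ wt (proj₂ (q k))

  deg : (Fin t → ℕ) → ℕ
  deg = ℕΣ.sum

  weight : (Fin t → ℕ) → ℕ
  weight e = ℕΣ.sum (λ k → e k ℕ.* blockWeight k)

  weight-cong : ∀ {e e′} → e ≗ e′ → weight e ≡ weight e′
  weight-cong e≗e′ = ℕΣ.sum-cong-≗ λ k → ≡.cong (ℕ._* blockWeight k) (e≗e′ k)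

  minorWeight : ∀ {m} → (Fin m → Fin n) → (Fin m → Fin n) → ℕ
  minorWeight ρ γ = ℕΣ.sum (wt ∘ ρ) ℕ.+ ℕΣ.sum (wt ∘ γ)

  rowsIn : ∀ {m} → (Fin m → Fin n) → Fin t → ℕ
  rowsIn ρ k = ℕΣ.sum (λ r → δ (block (ρ r)) k)

  ≐-blockWeight : ∀ {r s k} → (r , s) ≐ q k → blockWeight k ≡ wt r ℕ.+ wt s
  ≐-blockWeight     (inj₁ (≡.refl , ≡.refl)) = ≡.refl
  ≐-blockWeight {k = k} (inj₂ (≡.refl , ≡.refl)) = ℕ.+-comm (wt (proj₁ (q k))) _

  minorWeight-expand : ∀ {m} (ρ γ : Fin (suc m) → Fin n) j →
    minorWeight ρ γ ≡ minorWeight (ρ ∘ suc) (γ ∘ punchIn j) ℕ.+ (wt (ρ zero) ℕ.+ wt (γ j))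
  minorWeight-expand ρ γ j =
    ≡.trans (≡.cong (wt (ρ zero) ℕ.+ ℕΣ.sum (wt ∘ ρ ∘ suc) ℕ.+_) (ℕΣ.sum-remove (wt ∘ γ)))
            (shuffle (wt (ρ zero)) _ (wt (γ j)) _)
    where
    shuffle : ∀ a b c d → (a ℕ.+ b) ℕ.+ (c ℕ.+ d) ≡ (b ℕ.+ d) ℕ.+ (a ℕ.+ c)
    shuffle = solve-∀

  deg-rowsIn : ∀ {m} (ρ : Fin m → Fin n) → deg (rowsIn ρ) ≡ m
  deg-rowsIn {m} ρ = begin
    ℕΣ.sum (λ k → ℕΣ.sum (λ r → δ (block (ρ r)) k)) ≡⟨ ℕΣ.∑-comm (λ k r → δ (block (ρ r)) k) ⟩
    ℕΣ.sum (λ r → ℕΣ.sum (δ (block (ρ r))))        ≡⟨ ℕΣ.sum-cong-≗ (ℕΣ.sum-δ₁ ∘ block ∘ ρ) ⟩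
    ℕΣ.sum {m} (λ _ → 1)                           ≡⟨ ℕΣ.sum-const-1 m ⟩
    m                                              ∎
    where open ≡.≡-Reasoning

  rowsIn-block : ∀ {m} (ρ : Fin (suc m) → Fin n) →
                 rowsIn ρ (block (ρ zero)) ≡ suc (rowsIn (ρ ∘ suc) (block (ρ zero)))
  rowsIn-block ρ = ≡.cong (ℕ._+ rowsIn (ρ ∘ suc) (block (ρ zero))) (δ-refl (block (ρ zero)))

  lower-rowsIn : ∀ {m} (ρ : Fin (suc m) → Fin n) → lower (block (ρ zero)) (rowsIn ρ) ≗ rowsIn (ρ ∘ suc)
  lower-rowsIn ρ k = ℕ.m+n∸m≡n (δ (block (ρ zero)) k) _

  card₂≗rowsIn : (λ k → card₂ (q k)) ≗ rowsIn (λ v → v)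
  card₂≗rowsIn k = ≡.trans (≡.sym (sum-[∈₂] (q k))) (ℕΣ.sum-cong-≗ λ v → ≡.sym (δ-block v k))

  weight-rowsIn-id : weight (rowsIn (λ v → v)) ≡ minorWeight (λ v → v) (λ v → v)
  weight-rowsIn-id = begin
    ℕΣ.sum (λ k → ℕΣ.sum (λ v → δ (block v) k) ℕ.* blockWeight k)
      ≡⟨ ℕΣ.sum-cong-≗ (λ k → ℕΣ.*-distribʳ-sum (blockWeight k) (λ v → δ (block v) k)) ⟩
    ℕΣ.sum (λ k → ℕΣ.sum (λ v → δ (block v) k ℕ.* blockWeight k))
      ≡⟨ ℕΣ.∑-comm (λ k v → δ (block v) k ℕ.* blockWeight k) ⟩
    ℕΣ.sum (λ v → ℕΣ.sum (λ k → δ (block v) k ℕ.* blockWeight k))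
      ≡⟨ ℕΣ.sum-cong-≗ (λ v → ≡.trans (ℕΣ.sum-δ (block v) blockWeight) (≐-blockWeight (≐-partner v))) ⟩
    ℕΣ.sum (λ v → wt v ℕ.+ wt (partner v))
      ≡⟨ ℕΣ.∑-distrib-+ wt (wt ∘ partner) ⟩
    ℕΣ.sum wt ℕ.+ ℕΣ.sum (wt ∘ partner)
      ≡⟨ ≡.cong (ℕΣ.sum wt ℕ.+_) (ℕΣ.∑-permute wt partnerPermutation) ⟨
    ℕΣ.sum wt ℕ.+ ℕΣ.sum wt ∎
    where
    open ≡.≡-Reasoning
    open import Data.Fin.Permutation using (Permutation′; permutation)
    partnerPermutation : Permutation′ n
    partnerPermutation = permutation partner partner partner-involutive partner-involutive

module LeadingCoefficient {c ℓ} (F : Field c ℓ) {n t : ℕ}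
  (A : OverField.Matrix F n) (B : Fin t → OverField.Matrix F n) (q : Fin t → Fin n × Fin n)
  (B-weaklySymmetric : ∀ k → OverField.WeaklySymmetric F (B k))
  (B-q : ∀ k → OverField.IsQ F (B k) (proj₁ (q k)) (proj₂ (q k)))
  (q-partition : OverField.Partition F q) where

  open Field F using (_≈_; 0#; sym; trans)
  open OverField F using (Mon)
  open FieldProperties F
  open Coefficients F
  open Pencil F A B
  open Blocks F q q-partition

  wt-< : ∀ {a b : Fin n} → toℕ a ℕ.< toℕ b → wt a ℕ.< wt b
  wt-< = ℕ.^-monoʳ-< 2 (ℕ.s≤s (ℕ.s≤s ℕ.z≤n))

  support-≤ : ∀ k {r s} → toℕ r ℕ.≤ toℕ s →
              B k r s ≈ 0# ⊎ (wt r ℕ.+ wt s ℕ.< blockWeight k ⊎ (r , s) ≐ q k)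
  support-≤ k {r} {s} r≤s with B-q k | ℕ.<-cmp (toℕ s) (toℕ (proj₂ (q k)))
  ... | _ , _ , maximal | tri> _ _ j<s = inj₁ (maximal r s r≤s (inj₁ j<s))
  ... | _ , _ , _       | tri< s<j _ _ = inj₂ (inj₁ (begin-strict
    wt r ℕ.+ wt s         ≤⟨ ℕ.+-monoˡ-≤ (wt s) (ℕ.^-monoʳ-≤ 2 r≤s) ⟩
    wt s ℕ.+ wt s         ≡⟨ ≡.cong (wt s ℕ.+_) (ℕ.+-identityʳ (wt s)) ⟨
    2 ℕ.^ suc (toℕ s)     ≤⟨ ℕ.^-monoʳ-≤ 2 s<j ⟩
    wt (proj₂ (q k))      <⟨ ℕ.m<n+m _ (ℕ.m^n>0 2 (toℕ (proj₁ (q k)))) ⟩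
    blockWeight k         ∎))
    where open ℕ.≤-Reasoning
  ... | _ , _ , maximal | tri≈ _ s≡j _ with ℕ.<-cmp (toℕ r) (toℕ (proj₁ (q k)))
  ...   | tri> _ _ i<r = inj₁ (maximal r s r≤s (inj₂ (Fin.toℕ-injective (≡.sym s≡j) , i<r)))
  ...   | tri≈ _ r≡i _ = inj₂ (inj₂ (inj₁ (Fin.toℕ-injective r≡i , Fin.toℕ-injective s≡j)))
  ...   | tri< r<i _ _ = inj₂ (inj₁ (ℕ.+-mono-<-≤ (wt-< r<i) (ℕ.≤-reflexive (≡.cong (2 ℕ.^_) s≡j))))

  -- Weak symmetry only transfers B k r s ≉ 0, hence the double negation below the diagonal.
  support : ∀ k r s → ¬ ¬ B k r s ≈ 0# ⊎ (wt r ℕ.+ wt s ℕ.< blockWeight k ⊎ (r , s) ≐ q k)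
  support k r s with toℕ r ℕ.≤? toℕ s
  ... | yes r≤s = Sum.map₁ (λ B≈0 B≉0 → B≉0 B≈0) (support-≤ k r≤s)
  ... | no  r≰s with support-≤ k (ℕ.<⇒≤ (ℕ.≰⇒> r≰s))
  ...   | inj₁ Bsr≈0          = inj₁ λ Brs≉0 → proj₁ (B-weaklySymmetric k r s) Brs≉0 Bsr≈0
  ...   | inj₂ (inj₁ lighter) = inj₂ (inj₁ (≡.subst (ℕ._< blockWeight k) (ℕ.+-comm (wt s) (wt r)) lighter))
  ...   | inj₂ (inj₂ sr≐q)    = inj₂ (inj₂ (≐-swap sr≐q))

  support-weak : ∀ k r s → ¬ ¬ B k r s ≈ 0# ⊎ wt r ℕ.+ wt s ℕ.≤ blockWeight k
  support-weak k r s with support k r s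
  ... | inj₁ ¬¬B≈0          = inj₁ ¬¬B≈0
  ... | inj₂ (inj₁ lighter) = inj₂ (ℕ.<⇒≤ lighter)
  ... | inj₂ (inj₂ rs≐q)    = inj₂ (ℕ.≤-reflexive (≡.sym (≐-blockWeight rs≐q)))

  ≐⇒B≉0 : ∀ {k r s} → (r , s) ≐ q k → ¬ B k r s ≈ 0#
  ≐⇒B≉0 {k} (inj₁ (≡.refl , ≡.refl)) = proj₁ (proj₂ (B-q k))
  ≐⇒B≉0 {k} (inj₂ (≡.refl , ≡.refl)) = proj₁ (B-weaklySymmetric k _ _) (proj₁ (proj₂ (B-q k)))

  deg-lower : ∀ e k {d} → e k ≡ suc d → suc (deg (lower k e)) ≡ deg e
  deg-lower = ℕΣ.sum-lower₁

  weight-lower : ∀ e k {d} → e k ≡ suc d → weight (lower k e) ℕ.+ blockWeight k ≡ weight e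
  weight-lower = ℕΣ.sum-lower blockWeight

  det-minor-coeff-above-size : ∀ m (ρ γ : Fin m → Fin n) e → m ℕ.< deg e → detₚ m (minor ρ γ) e ≈ 0#
  det-minor-coeff-above-size zero    ρ γ e 0<deg   = Field.reflexive F (constP-deg>0 (Field.1# F) e 0<deg)
  det-minor-coeff-above-size (suc m) ρ γ e 1+m<deg = trans (coeff-det-minor ρ γ e) (sum≈0 λ j →
    expansionTerm≈0 ρ γ e j (constant≈0 j) (variable≈0 j))
    where
    constant≈0 : ∀ j → constantTerm ρ γ e j ≈ 0#
    constant≈0 j = y≈0⇒x*y≈0 (det-minor-coeff-above-size m _ _ e (ℕ.<-trans (ℕ.n<1+n m) 1+m<deg))
    variable≈0 : ∀ j k → variableTerm ρ γ e j k ≈ 0#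
    variable≈0 j k with e k in eₖ
    ... | zero  = variableTerm-zero ρ γ e j k eₖ
    ... | suc d = trans (variableTerm-lower ρ γ e j k eₖ) (y≈0⇒x*y≈0 (det-minor-coeff-above-size m _ _ (lower k e)
                    (ℕ.s<s⁻¹ (≡.subst (suc m ℕ.<_) (≡.sym (deg-lower e k eₖ)) 1+m<deg))))

  constantTerm≈0 : ∀ {m} (ρ γ : Fin (suc m) → Fin n) e j → deg e ≡ suc m → constantTerm ρ γ e j ≈ 0#
  constantTerm≈0 {m} ρ γ e j deg≡1+m =
    y≈0⇒x*y≈0 (det-minor-coeff-above-size m _ _ e (ℕ.≤-reflexive (≡.sym deg≡1+m)))

  det-minor-coeff-light : ∀ m (ρ γ : Fin m → Fin n) e → deg e ≡ m → weight e ℕ.< minorWeight ρ γ →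
                          ¬ ¬ detₚ m (minor ρ γ) e ≈ 0#
  det-minor-coeff-light zero    ρ γ e _       ()
  det-minor-coeff-light (suc m) ρ γ e deg≡1+m light = ¬¬-map (trans (coeff-det-minor ρ γ e)) (¬¬-sum≈0 λ j →
    ¬¬-map (expansionTerm≈0 ρ γ e j (constantTerm≈0 ρ γ e j deg≡1+m)) (¬¬-∀ (variable≈0 j)))
    where
    variable≈0 : ∀ j k → ¬ ¬ variableTerm ρ γ e j k ≈ 0#
    variable≈0 j k with e k in eₖ
    ... | zero  = λ ≉0 → ≉0 (variableTerm-zero ρ γ e j k eₖ)
    ... | suc d with support-weak k (ρ zero) (γ j)
    ...   | inj₁ ¬¬B≈0 = ¬¬-map x≈0⇒x*y≈0 ¬¬B≈0
    ...   | inj₂ wt≤   = ¬¬-map (λ c≈0 → trans (variableTerm-lower ρ γ e j k eₖ) (y≈0⇒x*y≈0 c≈0))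
      (det-minor-coeff-light m _ _ (lower k e) (ℕ.suc-injective (≡.trans (deg-lower e k eₖ) deg≡1+m))
        (+-cancel-<-≤ (begin-strict
          weight (lower k e) ℕ.+ blockWeight k                                 ≡⟨ weight-lower e k eₖ ⟩
          weight e                                                             <⟨ light ⟩
          minorWeight ρ γ                                                      ≡⟨ minorWeight-expand ρ γ j ⟩
          minorWeight (ρ ∘ suc) (γ ∘ punchIn j) ℕ.+ (wt (ρ zero) ℕ.+ wt (γ j))  ∎) wt≤))
      where open ℕ.≤-Reasoning

  variableTerm-unmatched : ∀ {m} (ρ γ : Fin (suc m) → Fin n) e j k → deg e ≡ suc m →
    weight e ℕ.≤ minorWeight ρ γ → ¬ (ρ zero , γ j) ≐ q k → ¬ ¬ variableTerm ρ γ e j k ≈ 0#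
  variableTerm-unmatched {m} ρ γ e j k deg≡1+m heavy unmatched with e k in eₖ
  ... | zero  = λ ≉0 → ≉0 (variableTerm-zero ρ γ e j k eₖ)
  ... | suc d with support k (ρ zero) (γ j)
  ...   | inj₁ ¬¬B≈0          = ¬¬-map x≈0⇒x*y≈0 ¬¬B≈0
  ...   | inj₂ (inj₂ matched) = ⊥-elim (unmatched matched)
  ...   | inj₂ (inj₁ lighter) = ¬¬-map (λ c≈0 → trans (variableTerm-lower ρ γ e j k eₖ) (y≈0⇒x*y≈0 c≈0))
    (det-minor-coeff-light m _ _ (lower k e) (ℕ.suc-injective (≡.trans (deg-lower e k eₖ) deg≡1+m))
      (+-cancel-≤-< (begin
        weight (lower k e) ℕ.+ blockWeight k                                 ≡⟨ weight-lower e k eₖ ⟩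
        weight e                                                             ≤⟨ heavy ⟩
        minorWeight ρ γ                                                      ≡⟨ minorWeight-expand ρ γ j ⟩
        minorWeight (ρ ∘ suc) (γ ∘ punchIn j) ℕ.+ (wt (ρ zero) ℕ.+ wt (γ j))  ∎) lighter))
    where open ℕ.≤-Reasoning

  partners-remain : ∀ {m} (ρ γ : Fin (suc m) → Fin n) → Injective _≡_ _≡_ ρ →
    (partner∈γ : ∀ r → ∃[ s ] γ s ≡ partner (ρ r)) →
    ∀ r → ∃[ s ] γ (punchIn (proj₁ (partner∈γ zero)) s) ≡ partner (ρ (suc r))
  partners-remain ρ γ ρ-inj partner∈γ r with partner∈γ zero | partner∈γ (suc r)
  ... | s₀ , γs₀≡ | s , γs≡ with s₀ Fin.≟ s
  ...   | yes ≡.refl = ⊥-elim (Fin.0≢1+n (ρ-inj (partner-injective (≡.trans (≡.sym γs₀≡) γs≡))))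
  ...   | no  s₀≢s   = Fin.punchOut s₀≢s , ≡.trans (≡.cong γ (Fin.punchIn-punchOut s₀≢s)) γs≡

  weight-bound-remains : ∀ {m} (ρ γ : Fin (suc m) → Fin n) s₀ → γ s₀ ≡ partner (ρ zero) →
    weight (rowsIn ρ) ℕ.≤ minorWeight ρ γ →
    weight (rowsIn (ρ ∘ suc)) ℕ.≤ minorWeight (ρ ∘ suc) (γ ∘ punchIn s₀)
  weight-bound-remains ρ γ s₀ γs₀≡partner heavy = ℕ.+-cancelʳ-≤ (blockWeight k₀) _ _ (begin
    weight (rowsIn (ρ ∘ suc)) ℕ.+ blockWeight k₀
      ≡⟨ ≡.cong (ℕ._+ blockWeight k₀) (weight-cong (≡.sym ∘ lower-rowsIn ρ)) ⟩
    weight (lower k₀ (rowsIn ρ)) ℕ.+ blockWeight k₀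
      ≡⟨ weight-lower (rowsIn ρ) k₀ (rowsIn-block ρ) ⟩
    weight (rowsIn ρ)
      ≤⟨ heavy ⟩
    minorWeight ρ γ
      ≡⟨ minorWeight-expand ρ γ s₀ ⟩
    minorWeight (ρ ∘ suc) (γ ∘ punchIn s₀) ℕ.+ (wt (ρ zero) ℕ.+ wt (γ s₀))
      ≡⟨ ≡.cong (minorWeight (ρ ∘ suc) (γ ∘ punchIn s₀) ℕ.+_)
                (≐-blockWeight (partner⇒≐ γs₀≡partner)) ⟨
    minorWeight (ρ ∘ suc) (γ ∘ punchIn s₀) ℕ.+ blockWeight k₀ ∎)
    where
    open ℕ.≤-Reasoning
    k₀ : Fin t
    k₀ = block (ρ zero)

  det-minor-coeff-matched : ∀ m (ρ γ : Fin m → Fin n) → Injective _≡_ _≡_ ρ → Injective _≡_ _≡_ γ →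
    (∀ r → ∃[ s ] γ s ≡ partner (ρ r)) → weight (rowsIn ρ) ℕ.≤ minorWeight ρ γ →
    ¬ detₚ m (minor ρ γ) (rowsIn ρ) ≈ 0#
  det-minor-coeff-matched zero ρ γ _ _ _ _ =
    ≡.subst (λ x → ¬ x ≈ 0#) (≡.sym (constP-deg≡0 (Field.1# F) (rowsIn ρ) (deg-rowsIn ρ))) (Field.1≉0 F)
  det-minor-coeff-matched (suc m) ρ γ ρ-inj γ-inj partner∈γ heavy det≈0 =
    sum≉0 s₀ others leading≉0 (trans (sym (coeff-det-minor ρ γ e)) det≈0)
    where
    e : Mon t
    e = rowsIn ρ
    k₀ : Fin t
    k₀ = block (ρ zero)
    s₀ : Fin (suc m)
    s₀ = proj₁ (partner∈γ zero)
    matched : (ρ zero , γ s₀) ≐ q k₀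
    matched = partner⇒≐ (proj₂ (partner∈γ zero))
    deg≡1+m : deg e ≡ suc m
    deg≡1+m = deg-rowsIn ρ
    unmatched : ∀ {s k} → (ρ zero , γ s) ≐ q k → s ≡ s₀ × k ≡ k₀
    unmatched ≐q = γ-inj (≡.trans (≐⇒partner ≐q) (≡.sym (proj₂ (partner∈γ zero)))) , ≐⇒block ≐q
    others : ∀ s → s ≢ s₀ → ¬ ¬ expansionTerm ρ γ e s ≈ 0#
    others s s≢s₀ = ¬¬-map (expansionTerm≈0 ρ γ e s (constantTerm≈0 ρ γ e s deg≡1+m))
      (¬¬-∀ λ k → variableTerm-unmatched ρ γ e s k deg≡1+m heavy (s≢s₀ ∘ proj₁ ∘ unmatched))
    cofactor≉0 : ¬ cofactor ρ γ s₀ (lower k₀ e) ≈ 0#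
    cofactor≉0 c≈0 = det-minor-coeff-matched m (ρ ∘ suc) (γ ∘ punchIn s₀) (Fin.suc-injective ∘ ρ-inj)
      (Fin.punchIn-injective s₀ _ _ ∘ γ-inj) (partners-remain ρ γ ρ-inj partner∈γ)
      (weight-bound-remains ρ γ s₀ (proj₂ (partner∈γ zero)) heavy)
      (trans (det-minor-cong m _ _ (≡.sym ∘ lower-rowsIn ρ)) c≈0)
    leading≉0 : ¬ expansionTerm ρ γ e s₀ ≈ 0#
    leading≉0 = *-≉0 (sgn≉0 (toℕ s₀)) λ Σ≈0 → sum≉0 k₀
      (λ k k≢k₀ → variableTerm-unmatched ρ γ e s₀ k deg≡1+m heavy (k≢k₀ ∘ proj₂ ∘ unmatched))
      (λ v≈0 → *-≉0 (≐⇒B≉0 matched) cofactor≉0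
                 (trans (sym (variableTerm-lower ρ γ e s₀ k₀ (rowsIn-block ρ))) v≈0))
      (trans (sym (x≈0⇒x+y≈y (constantTerm≈0 ρ γ e s₀ deg≡1+m))) Σ≈0)

proposition2p1 : ∀ {c ℓ p} (F : Field c ℓ) (n t : ℕ) →
    let open Field F using (_≈_) in
    let open OverField F in
    (A : Matrix n) (𝓑 : Matrix n → Set p) → IsSubspace 𝓑 →
    (∀ B → 𝓑 B → WeaklySymmetric B) →
    (B : Fin t → Matrix n) → (∀ k → 𝓑 (B k)) →
    (∀ k → ¬ (B k ≈ᴹ 0ᴹ)) →
    (q : Fin t → Fin n × Fin n) →
    (∀ k → IsQ (B k) (Data.Product.proj₁ (q k)) (Data.Product.proj₂ (q k))) →
    Partition q →
    ¬ (coeff (detPencil A B) (λ k → card₂ (q k)) ≈ Field.0# F)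
proposition2p1 F n t A 𝓑 _ 𝓑-weaklySymmetric B B∈𝓑 _ q B-q q-partition coeff≈0 =
  det-minor-coeff-matched n id id id id (λ v → partner v , ≡.refl) (ℕ.≤-reflexive weight-rowsIn-id)
    (Field.trans F (Field.sym F (det-minor-cong n id id card₂≗rowsIn)) coeff≈0)
  where
  open LeadingCoefficient F A B q (λ k → 𝓑-weaklySymmetric (B k) (B∈𝓑 k)) B-q q-partition
  open Pencil F A B using (det-minor-cong)
  open Blocks F q q-partition
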